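{- 1. If $\varphi:\mathbb N\to\mathbb N$ is total recursive and tends to $+\infty$, then $\{x:K(x)<\varphi(x)\}$ is an r.e. set which is constructively $\Sigma^0_1$-dense. Moreover, uniformly: for acceptable enumerations $(\varphi_i)$ of partial recursive functions $\mathbb N\to\mathbb N$ and $(W_i)$ of r.e. subsets of $\mathbb N$, there are total recursive $\xi:\mathbb N\to\mathbb N$ and $\theta:\mathbb N^2\to\mathbb N$ such that (i) for all $i$, $\{x\in dom(\varphi_i):K(x)<\varphi_i(x)\}=W_{\xi(i)}$; (ii) for all $i,j$, if $\varphi_i$ is unbounded on $dom(\varphi_i)\cap W_j$ then $W_{\theta(i,j)}$ is infinite and $W_{\theta(i,j)}\subseteq W_j\cap\{x:K(x)<\varphi_i(x)\}$. 2. (Uniform relativization.) Let $(\Phi_i)$ be an acceptable enumeration of partial computable functionals $\mathbb N\times P(\mathbb N)\to\mathbb N$, $\varphi^A_i(x)=\Phi_i(x,A)$, $W^A_i=dom(\varphi^A_i)$, and $K^A(x)=\mathcal K(x\,\|\,A)$. Then there are total recursive $\xi:\mathbb N\to\mathbb N$, $\theta:\mathbb N^2\to\mathbb N$ such that for all $i,j$ and all $A\subseteq\mathbb N$: (i) $\{x\in dom(\varphi^A_i):K^A(x)<\varphi^A_i(x)\}=W^A_{\xi(i)}$; (ii) if $\varphi^A_i$ is unbounded on $dom(\varphi^A_i)\cap W^A_j$, then $W^A_{\theta(i,j)}$ is infinite and $W^A_{\theta(i,j)}\subseteq W^A_j\cap\{x:K^A(x)<\varphi^A_i(x)\}$.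
   Context: $K:\mathbb N\to\mathbb N$ is (a fixed version of) Kolmogorov complexity, $K(x)=\min\{|p|:U(p)=x\}$ for a fixed optimal partial recursive $U:\{0,1\}^*\to\mathbb N$. A set $Z\subseteq\mathbb N$ is constructively $\Sigma^0_1$-dense if there is a total recursive $\lambda$ such that whenever $W_i$ is infinite, $W_{\lambda(i)}$ is an infinite subset of $Z\cap W_i$. Acceptable enumeration of partial computable functionals (computed by oracle Turing machines): $(i,x,A)\mapsto\Phi_i(x,A)$ is partial computable, every partial computable functional $\mathbb N\times P(\mathbb N)\to\mathbb N$ occurs, and the s-m-n property holds (a total recursive $s$ with $\Phi_i(\langle z,x\rangle,A)=\Phi_{s(i,z)}(x,A)$). $\mathcal K(x\,\|\,A)=\min\{|p|:\mathcal U(p,A)=x\}$ for a fixed optimal partial computable functional $\mathcal U:\{0,1\}^*\times P(\mathbb N)\to\mathbb N$ (optimal: for every partial computable $G$ there is $c$ with $\mathcal K_{\mathcal U}(x\|A)\le\mathcal K_G(x\|A)+c$ for all $x,A$). -}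

module Defs where

open import Data.Nat using (ℕ; zero; suc; _+_; _*_; _≤_; _<_)
open import Data.Bool using (Bool; true; false; if_then_else_)
open import Data.Fin using (Fin)
open import Data.Vec using (Vec; []; _∷_; lookup)
open import Data.List using (List; []; _∷_; length)
open import Data.Product using (Σ; ∃; _×_; _,_)
open import Function.Bundles using (_⇔_)

-- Model of computation: partial μ-recursive functions with an oracle.
-- PR n = codes of n-ary partial computable functionals.

Oracle : Set
Oracle = ℕ → Bool          -- a subset A ⊆ ℕ, given by its characteristic function

∅ : Oracle
∅ _ = false

data PR : ℕ → Set where
  Zr  : ∀ {n} → PR n
  Sc  : PR 1
  Pj  : ∀ {n} → Fin n → PR n
  Cp  : ∀ {n m} → PR m → Vec (PR n) m → PR n
  Rc  : ∀ {n} → PR n → PR (suc (suc n)) → PR (suc n)  -- primitive recursion (on 1st arg)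
  Mu  : ∀ {n} → PR (suc n) → PR n
  Or  : PR 1

mutual
  data Ev (A : Oracle) : ∀ {n} → PR n → Vec ℕ n → ℕ → Set where
    ev-Zr : ∀ {n} {xs : Vec ℕ n} → Ev A Zr xs 0
    ev-Sc : ∀ {x} → Ev A Sc (x ∷ []) (suc x)
    ev-Pj : ∀ {n} {k : Fin n} {xs} → Ev A (Pj k) xs (lookup xs k)
    ev-Cp : ∀ {n m} {f : PR m} {gs : Vec (PR n) m} {xs ys y} →
            EvV A gs xs ys → Ev A f ys y → Ev A (Cp f gs) xs y
    ev-Rz : ∀ {n} {f : PR n} {g} {xs y} →
            Ev A f xs y → Ev A (Rc f g) (0 ∷ xs) y
    ev-Rs : ∀ {n} {f : PR n} {g} {k xs r y} →
            Ev A (Rc f g) (k ∷ xs) r → Ev A g (k ∷ r ∷ xs) y →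
            Ev A (Rc f g) (suc k ∷ xs) y
    ev-Mu : ∀ {n} {f : PR (suc n)} {xs y} →
            Ev A f (y ∷ xs) 0 →
            (∀ z → z < y → Σ ℕ λ v → Ev A f (z ∷ xs) (suc v)) →
            Ev A (Mu f) xs y
    ev-Or : ∀ {x} → Ev A Or (x ∷ []) (if A x then 1 else 0)

  data EvV (A : Oracle) : ∀ {n m} → Vec (PR n) m → Vec ℕ n → Vec ℕ m → Set where
    evv-[] : ∀ {n} {xs : Vec ℕ n} → EvV A [] xs []
    evv-∷  : ∀ {n m} {g : PR n} {gs : Vec (PR n) m} {xs y ys} →
             Ev A g xs y → EvV A gs xs ys → EvV A (g ∷ gs) xs (y ∷ ys)

Computable₁ : (ℕ → ℕ) → Set
Computable₁ f = Σ (PR 1) λ c → ∀ x → Ev ∅ c (x ∷ []) (f x)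

Computable₂ : (ℕ → ℕ → ℕ) → Set
Computable₂ f = Σ (PR 2) λ c → ∀ x y → Ev ∅ c (x ∷ y ∷ []) (f x y)

RE : (ℕ → Set) → Set
RE S = Σ (PR 1) λ c → ∀ x → S x ⇔ (∃ λ y → Ev ∅ c (x ∷ []) y)

tri : ℕ → ℕ
tri zero = 0
tri (suc n) = suc n + tri n

⟨_,_⟩ : ℕ → ℕ → ℕ
⟨ z , x ⟩ = tri (z + x) + x

-- bijective coding of binary strings {0,1}* by natural numbers
enc : List Bool → ℕ
enc [] = 0
enc (false ∷ s) = suc (2 * enc s)
enc (true ∷ s) = suc (suc (2 * enc s))

-- partial recursive functions ℕ → ℕ, given by graphs φ i x y  ("φ_i(x) = y")
AcceptablePR : (ℕ → ℕ → ℕ → Set) → Set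
AcceptablePR φ =
  (Σ (PR 2) λ u → ∀ i x y → φ i x y ⇔ Ev ∅ u (i ∷ x ∷ []) y)
  × (∀ (c : PR 1) → Σ ℕ λ i → ∀ x y → φ i x y ⇔ Ev ∅ c (x ∷ []) y)
  × (Σ (ℕ → ℕ → ℕ) λ s → Computable₂ s × (∀ i z x y → φ (s i z) x y ⇔ φ i ⟨ z , x ⟩ y))

AcceptableRE : (ℕ → ℕ → Set) → Set
AcceptableRE W =
  (Σ (PR 2) λ u → ∀ i x → W i x ⇔ (∃ λ y → Ev ∅ u (i ∷ x ∷ []) y))
  × (∀ (c : PR 1) → Σ ℕ λ i → ∀ x → W i x ⇔ (∃ λ y → Ev ∅ c (x ∷ []) y))
  × (Σ (ℕ → ℕ → ℕ) λ s → Computable₂ s × (∀ i z x → W (s i z) x ⇔ W i ⟨ z , x ⟩))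

-- partial computable functionals ℕ × P(ℕ) → ℕ, graphs Φ i x A y ("Φ_i(x,A) = y")
AcceptableFunctional : (ℕ → ℕ → Oracle → ℕ → Set) → Set
AcceptableFunctional Φ =
  (Σ (PR 2) λ u → ∀ i x A y → Φ i x A y ⇔ Ev A u (i ∷ x ∷ []) y)
  × (∀ (c : PR 1) → Σ ℕ λ i → ∀ x A y → Φ i x A y ⇔ Ev A c (x ∷ []) y)
  × (Σ (ℕ → ℕ → ℕ) λ s → Computable₂ s × (∀ i z x A y → Φ (s i z) x A y ⇔ Φ i ⟨ z , x ⟩ A y))

-- U (a code, run without oracle, on enc p) is an optimal partial recursive {0,1}* → ℕ:
-- K_U(x) ≤ K_G(x) + c, unfolded through the definition of K as a minimum.
Optimal : PR 1 → Set
Optimal u = ∀ (g : PR 1) → Σ ℕ λ c → ∀ p x → Ev ∅ g (enc p ∷ []) x →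
            Σ (List Bool) λ q → Ev ∅ u (enc q ∷ []) x × length q ≤ length p + c

OptimalFunctional : PR 1 → Set
OptimalFunctional u = ∀ (g : PR 1) → Σ ℕ λ c → ∀ A p x → Ev A g (enc p ∷ []) x →
            Σ (List Bool) λ q → Ev A u (enc q ∷ []) x × length q ≤ length p + c

-- K_U(x) < n   (K(x) = min{|p| : U(p) = x}), and its relativisation 𝒦(x ‖ A) < n
Klt : PR 1 → ℕ → ℕ → Set
Klt u x n = Σ (List Bool) λ p → Ev ∅ u (enc p ∷ []) x × length p < n

KA< : PR 1 → Oracle → ℕ → ℕ → Set
KA< u A x n = Σ (List Bool) λ p → Ev A u (enc p ∷ []) x × length p < n

Infinite : (ℕ → Set) → Set
Infinite S = ∀ n → ∃ λ x → n ≤ x × S x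

TendsToInfinity : (ℕ → ℕ) → Set
TendsToInfinity f = ∀ n → ∃ λ m → ∀ x → m ≤ x → n ≤ f x

ConstructivelyDense : (ℕ → ℕ → Set) → (ℕ → Set) → Set
ConstructivelyDense W Z = Σ (ℕ → ℕ) λ l → Computable₁ l ×
  (∀ i → Infinite (W i) → Infinite (W (l i)) × (∀ x → W (l i) x → Z x × W i x))

module Submission where

-- A clocked interpreter,
-- itself primitive recursive, turns convergence into the existence of a time bound, so the
-- relation K(x) < φ_i(x), i.e. ∃ p. U(p) = x ∧ |p| < φ_i(x), is semi-decidable uniformly in i
-- and the oracle; s-m-n then gives ξ.
-- For θ, let F(i, j, n) be the first x enumerated into W_j with φ_i(x) > n. Feeding F the
-- numbers enc p, optimality gives K(F(i, j, enc p)) ≤ |p| + c < enc p < φ_i(F(i, j, enc p)) for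
-- long p, so the values of F satisfying K(x) < φ_i(x) form an r.e. subset of W_j on which φ_i
-- is unbounded, hence an infinite one.

open import Data.Bool using (Bool; true; false; if_then_else_)
open import Data.Empty using (⊥-elim)
open import Data.Fin using (Fin; zero; suc; #_; _↑ʳ_)
open import Data.List using (List; []; _∷_; length)
open import Data.Nat
open import Data.Nat.Properties
open import Data.Product using (Σ; ∃; _×_; _,_; proj₁; proj₂; map₁; map₂)
open import Data.Sum using (_⊎_; inj₁; inj₂)
open import Data.Vec using (Vec; []; _∷_; lookup; tabulate; map; _++_)
open import Data.Vec.Properties using (tabulate∘lookup; tabulate-cong; lookup-++ʳ)
open import Defs
open import Function using (_∘_; id)
open import Function.Bundles using (_⇔_; mk⇔; module Equivalence)
open import Function.Properties.Equivalence using () renaming (trans to ⇔-trans; sym to ⇔-sym)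
open import Relation.Binary.Definitions using (tri<; tri≈; tri>)
open import Relation.Binary.PropositionalEquality
open import Relation.Nullary using (yes; no)

ev-Cp₁ : ∀ {A n} {f : PR 1} {g : PR n} {xs a y} →
         Ev A g xs a → Ev A f (a ∷ []) y → Ev A (Cp f (g ∷ [])) xs y
ev-Cp₁ eg ef = ev-Cp (evv-∷ eg evv-[]) ef

ev-Cp₂ : ∀ {A n} {f : PR 2} {g h : PR n} {xs a b y} →
         Ev A g xs a → Ev A h xs b → Ev A f (a ∷ b ∷ []) y → Ev A (Cp f (g ∷ h ∷ [])) xs y
ev-Cp₂ eg eh ef = ev-Cp (evv-∷ eg (evv-∷ eh evv-[])) ef

ev-Cp₃ : ∀ {A n} {f : PR 3} {g h k : PR n} {xs a b c y} →
         Ev A g xs a → Ev A h xs b → Ev A k xs c → Ev A f (a ∷ b ∷ c ∷ []) y →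
         Ev A (Cp f (g ∷ h ∷ k ∷ [])) xs y
ev-Cp₃ eg eh ek ef = ev-Cp (evv-∷ eg (evv-∷ eh (evv-∷ ek evv-[]))) ef

constC : ∀ {n} → ℕ → PR n
constC zero    = Zr
constC (suc k) = Cp Sc (constC k ∷ [])

ev-const : ∀ {A n} k {xs : Vec ℕ n} → Ev A (constC k) xs k
ev-const zero    = ev-Zr
ev-const (suc k) = ev-Cp₁ (ev-const k) ev-Sc

dropC : ∀ {n} k → Vec (PR (k + n)) n
dropC k = tabulate (λ i → Pj (k ↑ʳ i))

evv-tabulate : ∀ {A n m} (f : Fin m → Fin n) {xs : Vec ℕ n} →
               EvV A (tabulate (Pj ∘ f)) xs (tabulate (lookup xs ∘ f))
evv-tabulate {m = zero}  f = evv-[]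
evv-tabulate {m = suc m} f = evv-∷ ev-Pj (evv-tabulate (f ∘ suc))

evv-drop : ∀ {A n k} (ys : Vec ℕ k) {xs : Vec ℕ n} → EvV A (dropC k) (ys ++ xs) xs
evv-drop {A} {k = k} ys {xs} =
  subst (EvV A (dropC k) (ys ++ xs))
        (trans (tabulate-cong (lookup-++ʳ ys xs)) (tabulate∘lookup xs))
        (evv-tabulate (k ↑ʳ_))

addC : PR 2
addC = Rc (Pj zero) (Cp Sc (Pj (# 1) ∷ []))

ev-add : ∀ {A} a b → Ev A addC (a ∷ b ∷ []) (a + b)
ev-add zero    b = ev-Rz ev-Pj
ev-add (suc a) b = ev-Rs (ev-add a b) (ev-Cp₁ ev-Pj ev-Sc)

mulC : PR 2
mulC = Rc Zr (Cp addC (Pj (# 2) ∷ Pj (# 1) ∷ []))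

ev-mul : ∀ {A} a b → Ev A mulC (a ∷ b ∷ []) (a * b)
ev-mul zero    b = ev-Rz ev-Zr
ev-mul (suc a) b = ev-Rs (ev-mul a b) (ev-Cp₂ ev-Pj ev-Pj (ev-add b (a * b)))

predC : PR 1
predC = Rc Zr (Pj zero)

ev-pred : ∀ {A} a → Ev A predC (a ∷ []) (pred a)
ev-pred zero    = ev-Rz ev-Zr
ev-pred (suc a) = ev-Rs (ev-pred a) ev-Pj

subFromC : PR 2
subFromC = Rc (Pj zero) (Cp predC (Pj (# 1) ∷ []))

ev-subFrom : ∀ {A} b a → Ev A subFromC (b ∷ a ∷ []) (a ∸ b)
ev-subFrom zero    a = ev-Rz ev-Pj
ev-subFrom (suc b) a = ev-Rs (ev-subFrom b a)
  (ev-Cp₁ ev-Pj (subst (Ev _ predC _) (pred[m∸n]≡m∸[1+n] a b) (ev-pred (a ∸ b))))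

monusC : PR 2
monusC = Cp subFromC (Pj (# 1) ∷ Pj (# 0) ∷ [])

ev-monus : ∀ {A} a b → Ev A monusC (a ∷ b ∷ []) (a ∸ b)
ev-monus a b = ev-Cp₂ ev-Pj ev-Pj (ev-subFrom b a)

ifz : ℕ → ℕ → ℕ → ℕ
ifz zero    b c = b
ifz (suc a) b c = c

ifzC : PR 3
ifzC = Rc (Pj zero) (Pj (# 3))

ev-ifz : ∀ {A} a b c → Ev A ifzC (a ∷ b ∷ c ∷ []) (ifz a b c)
ev-ifz zero    b c = ev-Rz ev-Pj
ev-ifz (suc a) b c = ev-Rs (ev-ifz a b c) ev-Pj

sg : ℕ → ℕ
sg a = ifz a 0 1

sgC : PR 1
sgC = Cp ifzC (Pj zero ∷ constC 0 ∷ constC 1 ∷ [])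

ev-sg : ∀ {A} a → Ev A sgC (a ∷ []) (sg a)
ev-sg a = ev-Cp₃ ev-Pj (ev-const 0) (ev-const 1) (ev-ifz a 0 1)

pow2C : PR 1
pow2C = Rc (constC 1) (Cp addC (Pj (# 1) ∷ Pj (# 1) ∷ []))

ev-pow2 : ∀ {A} a → Ev A pow2C (a ∷ []) (2 ^ a)
ev-pow2 zero    = ev-Rz (ev-const 1)
ev-pow2 (suc a) = ev-Rs (ev-pow2 a)
  (ev-Cp₂ ev-Pj ev-Pj (subst (Ev _ addC _) (cong (2 ^ a +_) (sym (+-identityʳ (2 ^ a))))
                                           (ev-add (2 ^ a) (2 ^ a))))

∣m-n∣≡m∸n+n∸m : ∀ m n → ∣ m - n ∣ ≡ m ∸ n + (n ∸ m)
∣m-n∣≡m∸n+n∸m zero    zero    = refl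
∣m-n∣≡m∸n+n∸m zero    (suc n) = refl
∣m-n∣≡m∸n+n∸m (suc m) zero    = sym (+-identityʳ (suc m))
∣m-n∣≡m∸n+n∸m (suc m) (suc n) = ∣m-n∣≡m∸n+n∸m m n

distC : PR 2
distC = Cp addC (monusC ∷ Cp monusC (Pj (# 1) ∷ Pj (# 0) ∷ []) ∷ [])

ev-dist : ∀ {A} a b → Ev A distC (a ∷ b ∷ []) ∣ a - b ∣
ev-dist a b = subst (Ev _ distC _) (sym (∣m-n∣≡m∸n+n∸m a b))
  (ev-Cp₂ (ev-monus a b) (ev-Cp₂ ev-Pj ev-Pj (ev-monus b a)) (ev-add _ _))

triC : PR 1
triC = Rc Zr (Cp addC (Cp Sc (Pj zero ∷ []) ∷ Pj (# 1) ∷ []))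

ev-tri : ∀ {A} a → Ev A triC (a ∷ []) (tri a)
ev-tri zero    = ev-Rz ev-Zr
ev-tri (suc a) = ev-Rs (ev-tri a) (ev-Cp₂ (ev-Cp₁ ev-Pj ev-Sc) ev-Pj (ev-add _ _))

prodBelow : (ℕ → ℕ) → ℕ → ℕ
prodBelow f zero    = 1
prodBelow f (suc b) = prodBelow f b * f b

prodBelowC : ∀ {n} → PR (suc n) → PR (suc n)
prodBelowC P = Rc (constC 1) (Cp mulC (Pj (# 1) ∷ Cp P (Pj zero ∷ dropC 2) ∷ []))

ev-prodBelow : ∀ {A n} (P : PR (suc n)) (f : ℕ → ℕ) {xs : Vec ℕ n} →
               (∀ z → Ev A P (z ∷ xs) (f z)) → ∀ b → Ev A (prodBelowC P) (b ∷ xs) (prodBelow f b)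
ev-prodBelow P f h zero    = ev-Rz (ev-const 1)
ev-prodBelow P f h (suc b) = ev-Rs (ev-prodBelow P f h b)
  (ev-Cp₂ ev-Pj (ev-Cp (evv-∷ ev-Pj (evv-drop (_ ∷ _ ∷ []))) (h b)) (ev-mul _ _))

prodBelow≡0⇒ : ∀ f b → prodBelow f b ≡ 0 → ∃ λ z → z < b × f z ≡ 0
prodBelow≡0⇒ f (suc b) e with m*n≡0⇒m≡0∨n≡0 (prodBelow f b) e
... | inj₁ e′ = let (z , z<b , fz≡0) = prodBelow≡0⇒ f b e′ in z , m<n⇒m<1+n z<b , fz≡0
... | inj₂ e′ = b , ≤-refl , e′

prodBelow-zero : ∀ f {b} z → z < b → f z ≡ 0 → prodBelow f b ≡ 0
prodBelow-zero f {suc b} z z<1+b fz≡0 with m<1+n⇒m<n∨m≡n z<1+b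
... | inj₁ z<b  rewrite prodBelow-zero f z z<b fz≡0 = refl
... | inj₂ refl rewrite fz≡0 = *-zeroʳ (prodBelow f b)

allPos : ∀ {m} → Vec ℕ m → ℕ
allPos []       = 1
allPos (r ∷ rs) = sg r * allPos rs

-- r z is the clocked value of the search body at z. The state stays 0 while the body returns
-- nonzero values, becomes suc (suc y) at the first y where it returns 0, and 1 once it meets a
-- candidate on which the body has not converged.
searchStep : ℕ → ℕ → ℕ
searchStep y r = ifz r 1 (ifz (pred r) (suc (suc y)) 0)

searchState : (ℕ → ℕ) → ℕ → ℕ
searchState r zero    = 0
searchState r (suc y) = ifz (searchState r y) (searchStep y (r y)) (searchState r y)

-- clocked A c t xs is suc y when c converges to y on xs with every μ-search cut off after t
-- candidates, and 0 otherwise.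
mutual
  clocked : ∀ {n} → Oracle → PR n → ℕ → Vec ℕ n → ℕ
  clocked A Zr        t xs       = 1
  clocked A Sc        t (x ∷ []) = suc (suc x)
  clocked A (Pj k)    t xs       = suc (lookup xs k)
  clocked A Or        t (x ∷ []) = suc (if A x then 1 else 0)
  clocked A (Cp f gs) t xs       = allPos (clockedV A gs t xs) * clocked A f t (map pred (clockedV A gs t xs))
  clocked A (Rc f g)  t (k ∷ xs) = clockedRc A f g t xs k
  clocked A (Mu f)    t xs       = searchState (λ z → clocked A f t (z ∷ xs)) t ∸ 1

  clockedV : ∀ {n m} → Oracle → Vec (PR n) m → ℕ → Vec ℕ n → Vec ℕ m
  clockedV A []       t xs = []
  clockedV A (g ∷ gs) t xs = clocked A g t xs ∷ clockedV A gs t xs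

  clockedRc : ∀ {n} → Oracle → PR n → PR (suc (suc n)) → ℕ → Vec ℕ n → ℕ → ℕ
  clockedRc A f g t xs zero    = clocked A f t xs
  clockedRc A f g t xs (suc k) =
    sg (clockedRc A f g t xs k) * clocked A g t (k ∷ pred (clockedRc A f g t xs k) ∷ xs)

allPosC : ∀ {k m} → Vec (PR k) m → PR k
allPosC []       = constC 1
allPosC (g ∷ gs) = Cp mulC (Cp sgC (g ∷ []) ∷ allPosC gs ∷ [])

ev-allPos : ∀ {A k m} {gs : Vec (PR k) m} {xs ys} → EvV A gs xs ys → Ev A (allPosC gs) xs (allPos ys)
ev-allPos evv-[]       = ev-const 1
ev-allPos (evv-∷ e es) = ev-Cp₂ (ev-Cp₁ e (ev-sg _)) (ev-allPos es) (ev-mul _ _)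

mapPredC : ∀ {k m} → Vec (PR k) m → Vec (PR k) m
mapPredC []       = []
mapPredC (g ∷ gs) = Cp predC (g ∷ []) ∷ mapPredC gs

evv-mapPred : ∀ {A k m} {gs : Vec (PR k) m} {xs ys} → EvV A gs xs ys → EvV A (mapPredC gs) xs (map pred ys)
evv-mapPred evv-[]       = evv-[]
evv-mapPred (evv-∷ e es) = evv-∷ (ev-Cp₁ e (ev-pred _)) (evv-mapPred es)

mutual
  clockedC : ∀ {n} → PR n → PR (suc n)
  clockedC Zr        = constC 1
  clockedC Sc        = Cp Sc (Cp Sc (Pj (# 1) ∷ []) ∷ [])
  clockedC (Pj k)    = Cp Sc (Pj (suc k) ∷ [])
  clockedC Or        = Cp Sc (Cp Or (Pj (# 1) ∷ []) ∷ [])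
  clockedC (Cp f gs) = Cp mulC (allPosC (clockedCV gs) ∷ Cp (clockedC f) (Pj zero ∷ mapPredC (clockedCV gs)) ∷ [])
  clockedC (Rc f g)  = Cp (clockedRcC f g) (Pj (# 1) ∷ Pj zero ∷ dropC 2)
  clockedC (Mu f)    = Cp monusC (Cp (searchStateC f) (Pj zero ∷ Pj zero ∷ dropC 1) ∷ constC 1 ∷ [])

  clockedCV : ∀ {n m} → Vec (PR n) m → Vec (PR (suc n)) m
  clockedCV []       = []
  clockedCV (g ∷ gs) = clockedC g ∷ clockedCV gs

  clockedRcC : ∀ {n} → PR n → PR (suc (suc n)) → PR (suc (suc n))
  clockedRcC f g = Rc (clockedC f)
    (Cp mulC (Cp sgC (Pj (# 1) ∷ []) ∷ Cp (clockedC g) (Pj (# 2) ∷ Pj zero ∷ Cp predC (Pj (# 1) ∷ []) ∷ dropC 3) ∷ []))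

  searchStateC : ∀ {n} → PR (suc n) → PR (suc (suc n))
  searchStateC {n} f = Rc (constC 0)
    (Cp ifzC (Pj (# 1)
              ∷ Cp ifzC (r ∷ constC 1 ∷ Cp ifzC (Cp predC (r ∷ []) ∷ Cp Sc (Cp Sc (Pj zero ∷ []) ∷ []) ∷ constC 0 ∷ []) ∷ [])
              ∷ Pj (# 1) ∷ []))
    where
    r : PR (suc (suc (suc n)))
    r = Cp (clockedC f) (Pj (# 2) ∷ Pj zero ∷ dropC 3)

mutual
  ev-clocked : ∀ {A n} (c : PR n) t xs → Ev A (clockedC c) (t ∷ xs) (clocked A c t xs)
  ev-clocked Zr        t xs       = ev-const 1
  ev-clocked Sc        t (x ∷ []) = ev-Cp₁ (ev-Cp₁ ev-Pj ev-Sc) ev-Sc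
  ev-clocked (Pj k)    t xs       = ev-Cp₁ ev-Pj ev-Sc
  ev-clocked Or        t (x ∷ []) = ev-Cp₁ (ev-Cp₁ ev-Pj ev-Or) ev-Sc
  ev-clocked (Cp f gs) t xs       = ev-Cp₂ (ev-allPos (evv-clocked gs t xs))
    (ev-Cp (evv-∷ ev-Pj (evv-mapPred (evv-clocked gs t xs))) (ev-clocked f t _)) (ev-mul _ _)
  ev-clocked (Rc f g)  t (k ∷ xs) = ev-Cp (evv-∷ ev-Pj (evv-∷ ev-Pj (evv-drop (_ ∷ _ ∷ [])))) (ev-clockedRc f g t xs k)
  ev-clocked (Mu f)    t xs       =
    ev-Cp₂ (ev-Cp (evv-∷ ev-Pj (evv-∷ ev-Pj (evv-drop (_ ∷ [])))) (ev-searchState f t xs t)) (ev-const 1) (ev-monus _ 1)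

  evv-clocked : ∀ {A n m} (gs : Vec (PR n) m) t xs → EvV A (clockedCV gs) (t ∷ xs) (clockedV A gs t xs)
  evv-clocked []       t xs = evv-[]
  evv-clocked (g ∷ gs) t xs = evv-∷ (ev-clocked g t xs) (evv-clocked gs t xs)

  ev-clockedRc : ∀ {A n} (f : PR n) g t xs k → Ev A (clockedRcC f g) (k ∷ t ∷ xs) (clockedRc A f g t xs k)
  ev-clockedRc f g t xs zero    = ev-Rz (ev-clocked f t xs)
  ev-clockedRc f g t xs (suc k) = ev-Rs (ev-clockedRc f g t xs k)
    (ev-Cp₂ (ev-Cp₁ ev-Pj (ev-sg _))
            (ev-Cp (evv-∷ ev-Pj (evv-∷ ev-Pj (evv-∷ (ev-Cp₁ ev-Pj (ev-pred _)) (evv-drop (_ ∷ _ ∷ _ ∷ [])))))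
                   (ev-clocked g t _))
            (ev-mul _ _))

  ev-searchState : ∀ {A n} (f : PR (suc n)) t xs y →
                   Ev A (searchStateC f) (y ∷ t ∷ xs) (searchState (λ z → clocked A f t (z ∷ xs)) y)
  ev-searchState f t xs zero    = ev-Rz (ev-const 0)
  ev-searchState f t xs (suc y) = ev-Rs (ev-searchState f t xs y)
    (ev-Cp₃ ev-Pj
            (ev-Cp₃ ev-r (ev-const 1)
                    (ev-Cp₃ (ev-Cp₁ ev-r (ev-pred _)) (ev-Cp₁ (ev-Cp₁ ev-Pj ev-Sc) ev-Sc) (ev-const 0) (ev-ifz _ _ _))
                    (ev-ifz _ _ _))
            ev-Pj (ev-ifz _ _ _))
    where
    ev-r : ∀ {A s} → Ev A (Cp (clockedC f) (Pj (# 2) ∷ Pj zero ∷ dropC 3)) (y ∷ s ∷ t ∷ xs) (clocked A f t (y ∷ xs))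
    ev-r = ev-Cp (evv-∷ ev-Pj (evv-∷ ev-Pj (evv-drop (_ ∷ _ ∷ _ ∷ [])))) (ev-clocked f t (y ∷ xs))

NonzeroResult : ℕ → Set
NonzeroResult a = ∃ λ v → a ≡ suc (suc v)

searchState≡0⇒ : ∀ r T → searchState r T ≡ 0 → ∀ z → z < T → NonzeroResult (r z)
searchState≡0⇒ r (suc T) e z z<1+T with searchState r T in eq
searchState≡0⇒ r (suc T) () z z<1+T | suc s
... | zero with m<1+n⇒m<n∨m≡n z<1+T
... | inj₁ z<T = searchState≡0⇒ r T eq z z<T
... | inj₂ refl with r z
... | suc (suc v) = v , refl
searchState≡0⇒ r (suc T) () z z<1+T | zero | inj₂ refl | zero
searchState≡0⇒ r (suc T) () z z<1+T | zero | inj₂ refl | suc zero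

searchState-found⇒ : ∀ r T y → searchState r T ≡ suc (suc y) →
                     r y ≡ 1 × (∀ z → z < y → NonzeroResult (r z)) × y < T
searchState-found⇒ r (suc T) y e with searchState r T in eq
... | suc s = let (ry≡1 , below , y<T) = searchState-found⇒ r T y (trans eq e) in ry≡1 , below , m<n⇒m<1+n y<T
... | zero with r T in er
searchState-found⇒ r (suc T) y ()   | zero | zero
searchState-found⇒ r (suc T) y refl | zero | suc zero    = er , searchState≡0⇒ r T eq , ≤-refl
searchState-found⇒ r (suc T) y ()   | zero | suc (suc _)

searchResult-sound : ∀ r T y → searchState r T ∸ 1 ≡ suc y →
                     r y ≡ 1 × (∀ z → z < y → NonzeroResult (r z)) × y < T
searchResult-sound r T y e with searchState r T in eq
searchResult-sound r T y ()   | zero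
searchResult-sound r T y ()   | suc zero
searchResult-sound r T y refl | suc (suc _) = searchState-found⇒ r T y eq

searchState-before : ∀ r y → (∀ z → z < y → NonzeroResult (r z)) → ∀ k → k ≤ y → searchState r k ≡ 0
searchState-before r y below zero    k≤y = refl
searchState-before r y below (suc k) k<y
  rewrite searchState-before r y below k (≤-trans (n≤1+n k) k<y)
  with below k k<y
... | v , e rewrite e = refl

searchState-after : ∀ r y → r y ≡ 1 → (∀ z → z < y → NonzeroResult (r z)) →
                    ∀ T → y < T → searchState r T ≡ suc (suc y)
searchState-after r y ry≡1 below (suc T) y<1+T with m<1+n⇒m<n∨m≡n y<1+T
... | inj₁ y<T  rewrite searchState-after r y ry≡1 below T y<T = refl
... | inj₂ refl rewrite searchState-before r y below y ≤-refl | ry≡1 = refl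

searchResult-complete : ∀ r y → r y ≡ 1 → (∀ z → z < y → NonzeroResult (r z)) →
                        ∀ T → y < T → searchState r T ∸ 1 ≡ suc y
searchResult-complete r y ry≡1 below T y<T rewrite searchState-after r y ry≡1 below T y<T = refl

sg*≡suc : ∀ a b y → sg a * b ≡ suc y → (∃ λ a′ → a ≡ suc a′) × b ≡ suc y
sg*≡suc (suc a) b y e = (a , refl) , trans (sym (*-identityˡ b)) e

allPos*≡suc : ∀ {m} (rs : Vec ℕ m) b y → allPos rs * b ≡ suc y → allPos rs ≡ 1 × b ≡ suc y
allPos*≡suc []           b y e = refl , trans (sym (*-identityˡ b)) e
allPos*≡suc (suc r ∷ rs) b y e rewrite +-identityʳ (allPos rs) = allPos*≡suc rs b y e

allPos-map-suc : ∀ {m} (ys : Vec ℕ m) → allPos (map suc ys) ≡ 1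
allPos-map-suc []       = refl
allPos-map-suc (y ∷ ys) rewrite allPos-map-suc ys = refl

map-pred-suc : ∀ {m} (ys : Vec ℕ m) → map pred (map suc ys) ≡ ys
map-pred-suc []       = refl
map-pred-suc (y ∷ ys) = cong (y ∷_) (map-pred-suc ys)

mutual
  clocked-sound : ∀ {A n} (c : PR n) t xs y → clocked A c t xs ≡ suc y → Ev A c xs y
  clocked-sound Zr        t xs       .0 refl = ev-Zr
  clocked-sound Sc        t (x ∷ []) .(suc x) refl = ev-Sc
  clocked-sound (Pj k)    t xs       _ refl = ev-Pj
  clocked-sound Or        t (x ∷ []) _ refl = ev-Or
  clocked-sound {A} (Cp f gs) t xs y e =
    let (all≡1 , e′) = allPos*≡suc (clockedV A gs t xs) _ y e in
    ev-Cp (clockedV-sound gs t xs all≡1) (clocked-sound f t _ y e′)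
  clocked-sound (Rc f g) t (k ∷ xs) y e = clockedRc-sound f g t xs k y e
  clocked-sound {A} (Mu f) t xs y e =
    let (f≡0 , below , _) = searchResult-sound (λ z → clocked A f t (z ∷ xs)) t y e in
    ev-Mu (clocked-sound f t (y ∷ xs) 0 f≡0)
          (λ z z<y → let (v , ev) = below z z<y in v , clocked-sound f t (z ∷ xs) (suc v) ev)

  clockedV-sound : ∀ {A n m} (gs : Vec (PR n) m) t xs → allPos (clockedV A gs t xs) ≡ 1 →
                   EvV A gs xs (map pred (clockedV A gs t xs))
  clockedV-sound []       t xs e = evv-[]
  clockedV-sound {A} (g ∷ gs) t xs e with sg*≡suc (clocked A g t xs) _ 0 e
  ... | (r , er) , e′ rewrite er = evv-∷ (clocked-sound g t xs r er) (clockedV-sound gs t xs e′)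

  clockedRc-sound : ∀ {A n} (f : PR n) g t xs k y → clockedRc A f g t xs k ≡ suc y → Ev A (Rc f g) (k ∷ xs) y
  clockedRc-sound f g t xs zero    y e = ev-Rz (clocked-sound f t xs y e)
  clockedRc-sound {A} f g t xs (suc k) y e with sg*≡suc (clockedRc A f g t xs k) _ y e
  ... | (r , er) , e′ rewrite er = ev-Rs (clockedRc-sound f g t xs k r er) (clocked-sound g t _ y e′)

mutual
  clocked-mono : ∀ {A n} (c : PR n) {t t′} xs y → t ≤ t′ → clocked A c t xs ≡ suc y → clocked A c t′ xs ≡ suc y
  clocked-mono Zr        xs       y t≤t′ e = e
  clocked-mono Sc        (x ∷ []) y t≤t′ e = e
  clocked-mono (Pj k)    xs       y t≤t′ e = e
  clocked-mono Or        (x ∷ []) y t≤t′ e = e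
  clocked-mono {A} (Cp f gs) {t} {t′} xs y t≤t′ e =
    let (all≡1 , e′) = allPos*≡suc (clockedV A gs t xs) _ y e in
    subst (λ rs → allPos rs * clocked A f t′ (map pred rs) ≡ suc y) (sym (clockedV-mono gs xs t≤t′ all≡1))
      (trans (cong (_* clocked A f t′ (map pred (clockedV A gs t xs))) all≡1)
        (trans (*-identityˡ _) (clocked-mono f _ y t≤t′ e′)))
  clocked-mono (Rc f g) (k ∷ xs) y t≤t′ e = clockedRc-mono f g xs k y t≤t′ e
  clocked-mono {A} (Mu f) {t} {t′} xs y t≤t′ e =
    let (f≡0 , below , y<t) = searchResult-sound (λ z → clocked A f t (z ∷ xs)) t y e in
    searchResult-complete (λ z → clocked A f t′ (z ∷ xs)) y (clocked-mono f (y ∷ xs) 0 t≤t′ f≡0)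
      (λ z z<y → let (v , ev) = below z z<y in v , clocked-mono f (z ∷ xs) (suc v) t≤t′ ev) t′ (≤-trans y<t t≤t′)

  clockedV-mono : ∀ {A n m} (gs : Vec (PR n) m) {t t′} xs → t ≤ t′ → allPos (clockedV A gs t xs) ≡ 1 →
                  clockedV A gs t′ xs ≡ clockedV A gs t xs
  clockedV-mono []       xs t≤t′ e = refl
  clockedV-mono {A} (g ∷ gs) {t} xs t≤t′ e with sg*≡suc (clocked A g t xs) _ 0 e
  ... | (r , er) , e′ = cong₂ _∷_ (trans (clocked-mono g xs r t≤t′ er) (sym er)) (clockedV-mono gs xs t≤t′ e′)

  clockedRc-mono : ∀ {A n} (f : PR n) g {t t′} xs k y → t ≤ t′ →
                   clockedRc A f g t xs k ≡ suc y → clockedRc A f g t′ xs k ≡ suc y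
  clockedRc-mono f g xs zero    y t≤t′ e = clocked-mono f xs y t≤t′ e
  clockedRc-mono {A} f g {t} xs (suc k) y t≤t′ e with sg*≡suc (clockedRc A f g t xs k) _ y e
  ... | (r , er) , e′ rewrite clockedRc-mono f g xs k r t≤t′ er | er =
    trans (+-identityʳ _) (clocked-mono g _ y t≤t′ e′)

mutual
  clocked-complete : ∀ {A n} {c : PR n} {xs y} → Ev A c xs y → ∃ λ t → clocked A c t xs ≡ suc y
  clocked-complete ev-Zr = 0 , refl
  clocked-complete {xs = x ∷ []} ev-Sc = 0 , refl
  clocked-complete ev-Pj = 0 , refl
  clocked-complete {xs = x ∷ []} ev-Or = 0 , refl
  clocked-complete {A} {xs = xs} (ev-Cp {f = f} {gs = gs} {ys = ys} {y = y} es ef)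
    with clockedV-complete es | clocked-complete ef
  ... | t₁ , e₁ | t₂ , e₂ = t₁ ⊔ t₂ , goal
    where
    args : clockedV A gs (t₁ ⊔ t₂) xs ≡ map suc ys
    args = trans (clockedV-mono gs xs (m≤m⊔n t₁ t₂) (trans (cong allPos e₁) (allPos-map-suc ys))) e₁
    goal : allPos (clockedV A gs (t₁ ⊔ t₂) xs) * clocked A f (t₁ ⊔ t₂) (map pred (clockedV A gs (t₁ ⊔ t₂) xs)) ≡ suc y
    goal rewrite args | allPos-map-suc ys | map-pred-suc ys =
      trans (+-identityʳ _) (clocked-mono f ys y (m≤n⊔m t₁ t₂) e₂)
  clocked-complete (ev-Rz e) = clocked-complete e
  clocked-complete {A} (ev-Rs {f = f} {g = g} {k = k} {xs = xs} {r = r} {y = y} e₁ e₂)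
    with clocked-complete e₁ | clocked-complete e₂
  ... | t₁ , q₁ | t₂ , q₂ = t₁ ⊔ t₂ ,
    trans (cong (λ R → sg R * clocked A g (t₁ ⊔ t₂) (k ∷ pred R ∷ xs)) (clockedRc-mono f g xs k r (m≤m⊔n t₁ t₂) q₁))
          (trans (+-identityʳ _) (clocked-mono g _ y (m≤n⊔m t₁ t₂) q₂))
  clocked-complete {A} (ev-Mu {f = f} {xs = xs} {y = y} e₀ below)
    with clocked-complete e₀ | clocked-complete-below {A} {f = f} {xs = xs} y below y ≤-refl
  ... | t₀ , q₀ | t₁ , q₁ = T ,
    searchResult-complete (λ z → clocked A f T (z ∷ xs)) y (clocked-mono f (y ∷ xs) 0 t₀≤T q₀)
      (λ z z<y → let (v , ev) = q₁ z z<y in v , clocked-mono f (z ∷ xs) (suc v) t₁≤T ev) T (m≤m⊔n (suc y) (t₀ ⊔ t₁))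
    where
    T : ℕ
    T = suc y ⊔ (t₀ ⊔ t₁)
    t₀≤T : t₀ ≤ T
    t₀≤T = ≤-trans (m≤m⊔n t₀ t₁) (m≤n⊔m (suc y) (t₀ ⊔ t₁))
    t₁≤T : t₁ ≤ T
    t₁≤T = ≤-trans (m≤n⊔m t₀ t₁) (m≤n⊔m (suc y) (t₀ ⊔ t₁))

  clocked-complete-below : ∀ {A n} {f : PR (suc n)} {xs : Vec ℕ n} y →
                           (∀ z → z < y → Σ ℕ λ v → Ev A f (z ∷ xs) (suc v)) →
                           ∀ k → k ≤ y → ∃ λ T → ∀ z → z < k → NonzeroResult (clocked A f T (z ∷ xs))
  clocked-complete-below y below zero    k≤y = 0 , λ z ()
  clocked-complete-below {A} {f = f} {xs = xs} y below (suc k) k<y with below k k<y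
  ... | v , ev with clocked-complete ev | clocked-complete-below y below k (≤-trans (n≤1+n k) k<y)
  ... | t₁ , q₁ | t₂ , q₂ = t₁ ⊔ t₂ , nonzero
    where
    nonzero : ∀ z → z < suc k → NonzeroResult (clocked A f (t₁ ⊔ t₂) (z ∷ xs))
    nonzero z z<1+k with m<1+n⇒m<n∨m≡n z<1+k
    ... | inj₁ z<k  = let (w , q) = q₂ z z<k in w , clocked-mono f (z ∷ xs) (suc w) (m≤n⊔m t₁ t₂) q
    ... | inj₂ refl = v , clocked-mono f (z ∷ xs) (suc v) (m≤m⊔n t₁ t₂) q₁

  clockedV-complete : ∀ {A n m} {gs : Vec (PR n) m} {xs ys} → EvV A gs xs ys → ∃ λ t → clockedV A gs t xs ≡ map suc ys
  clockedV-complete evv-[] = 0 , refl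
  clockedV-complete {A} {gs = g ∷ gs} {xs = xs} {ys = y ∷ ys} (evv-∷ e es) with clocked-complete e | clockedV-complete es
  ... | t₁ , q₁ | t₂ , q₂ = t₁ ⊔ t₂ ,
    cong₂ _∷_ (clocked-mono g xs y (m≤m⊔n t₁ t₂) q₁)
              (trans (clockedV-mono gs xs (m≤n⊔m t₁ t₂) (trans (cong allPos q₂) (allPos-map-suc ys))) q₂)

mutual
  Ev-functional : ∀ {A n} {c : PR n} {xs y y′} → Ev A c xs y → Ev A c xs y′ → y ≡ y′
  Ev-functional ev-Zr ev-Zr = refl
  Ev-functional ev-Sc ev-Sc = refl
  Ev-functional ev-Pj ev-Pj = refl
  Ev-functional ev-Or ev-Or = refl
  Ev-functional (ev-Cp es e) (ev-Cp es′ e′) with EvV-functional es es′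
  ... | refl = Ev-functional e e′
  Ev-functional (ev-Rz e) (ev-Rz e′) = Ev-functional e e′
  Ev-functional (ev-Rs e₁ e₂) (ev-Rs e₁′ e₂′) with Ev-functional e₁ e₁′
  ... | refl = Ev-functional e₂ e₂′
  Ev-functional (ev-Mu {y = y} e₀ below) (ev-Mu {y = y′} e₀′ below′) with <-cmp y y′
  ... | tri≈ _ y≡y′ _ = y≡y′
  ... | tri< y<y′ _ _ with below′ y y<y′
  ... | v , ev with Ev-functional e₀ ev
  ... | ()
  Ev-functional (ev-Mu {y = y} e₀ below) (ev-Mu {y = y′} e₀′ below′) | tri> _ _ y′<y with below y′ y′<y
  ... | v , ev with Ev-functional e₀′ ev
  ... | ()

  EvV-functional : ∀ {A n m} {gs : Vec (PR n) m} {xs ys ys′} → EvV A gs xs ys → EvV A gs xs ys′ → ys ≡ ys′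
  EvV-functional evv-[]       evv-[]         = refl
  EvV-functional (evv-∷ e es) (evv-∷ e′ es′) = cong₂ _∷_ (Ev-functional e e′) (EvV-functional es es′)

LeastZero : (ℕ → ℕ) → ℕ → Set
LeastZero g y = g y ≡ 0 × (∀ z → z < y → ∃ λ v → g z ≡ suc v)

leastZero-below? : (g : ℕ → ℕ) → ∀ k → (∃ λ y → y < k × LeastZero g y) ⊎ (∀ z → z < k → ∃ λ v → g z ≡ suc v)
leastZero-below? g zero = inj₂ (λ z ())
leastZero-below? g (suc k) with leastZero-below? g k
... | inj₁ (y , y<k , least) = inj₁ (y , m<n⇒m<1+n y<k , least)
... | inj₂ nonzero with g k in eq
... | zero  = inj₁ (k , ≤-refl , eq , nonzero)
... | suc v = inj₂ nonzero′
  where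
  nonzero′ : ∀ z → z < suc k → ∃ λ w → g z ≡ suc w
  nonzero′ z z<1+k with m<1+n⇒m<n∨m≡n z<1+k
  ... | inj₁ z<k  = nonzero z z<k
  ... | inj₂ refl = v , eq

leastZero : (g : ℕ → ℕ) → ∀ y → g y ≡ 0 → ∃ λ y′ → LeastZero g y′
leastZero g y gy≡0 with leastZero-below? g (suc y)
... | inj₁ (y′ , _ , least) = y′ , least
... | inj₂ nonzero with nonzero y ≤-refl
... | v , gy≡1+v = ⊥-elim (0≢1+n (trans (sym gy≡0) gy≡1+v))

ev-Mu-total : ∀ {A n} (c : PR (suc n)) (g : ℕ → ℕ) {xs : Vec ℕ n} → (∀ z → Ev A c (z ∷ xs) (g z)) →
              ∀ y → g y ≡ 0 → ∃ λ y′ → g y′ ≡ 0 × Ev A (Mu c) xs y′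
ev-Mu-total c g evc y gy≡0 with leastZero g y gy≡0
... | y′ , gy′≡0 , nonzero =
  y′ , gy′≡0 , ev-Mu (subst (Ev _ c _) gy′≡0 (evc y′))
                     (λ z z<y′ → let (v , gz≡1+v) = nonzero z z<y′ in v , subst (Ev _ c _) gz≡1+v (evc z))

Mu-total-zero : ∀ {A n} (c : PR (suc n)) (g : ℕ → ℕ) {xs : Vec ℕ n} → (∀ z → Ev A c (z ∷ xs) (g z)) →
                ∀ {y} → Ev A (Mu c) xs y → g y ≡ 0
Mu-total-zero c g evc (ev-Mu e₀ _) = Ev-functional (evc _) e₀

infixl 6 _⊕_ _⊖_
infixl 7 _⊗_

data Expr (n : ℕ) : Set where
  var   : Fin n → Expr n
  lit   : ℕ → Expr n
  _⊕_   : Expr n → Expr n → Expr n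
  _⊖_   : Expr n → Expr n → Expr n
  _⊗_   : Expr n → Expr n → Expr n
  pow2E : Expr n → Expr n
  triE  : Expr n → Expr n
  distE : Expr n → Expr n → Expr n
  runE  : ∀ {k} → PR k → Expr n → Vec (Expr n) k → Expr n
  prodE : Expr n → Expr (suc n) → Expr n

mutual
  evalE : ∀ {n} → Oracle → Expr n → Vec ℕ n → ℕ
  evalE A (var i)        xs = lookup xs i
  evalE A (lit c)        xs = c
  evalE A (a ⊕ b)        xs = evalE A a xs + evalE A b xs
  evalE A (a ⊖ b)        xs = evalE A a xs ∸ evalE A b xs
  evalE A (a ⊗ b)        xs = evalE A a xs * evalE A b xs
  evalE A (pow2E a)      xs = 2 ^ evalE A a xs
  evalE A (triE a)       xs = tri (evalE A a xs)
  evalE A (distE a b)    xs = ∣ evalE A a xs - evalE A b xs ∣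
  evalE A (runE c t as)  xs = clocked A c (evalE A t xs) (evalEs A as xs)
  evalE A (prodE b body) xs = prodBelow (λ z → evalE A body (z ∷ xs)) (evalE A b xs)

  evalEs : ∀ {n k} → Oracle → Vec (Expr n) k → Vec ℕ n → Vec ℕ k
  evalEs A []       xs = []
  evalEs A (a ∷ as) xs = evalE A a xs ∷ evalEs A as xs

pairE : ∀ {n} → Expr n → Expr n → Expr n
pairE a b = triE (a ⊕ b) ⊕ b

mutual
  compile : ∀ {n} → Expr n → PR n
  compile (var i)        = Pj i
  compile (lit c)        = constC c
  compile (a ⊕ b)        = Cp addC (compile a ∷ compile b ∷ [])
  compile (a ⊖ b)        = Cp monusC (compile a ∷ compile b ∷ [])
  compile (a ⊗ b)        = Cp mulC (compile a ∷ compile b ∷ [])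
  compile (pow2E a)      = Cp pow2C (compile a ∷ [])
  compile (triE a)       = Cp triC (compile a ∷ [])
  compile (distE a b)    = Cp distC (compile a ∷ compile b ∷ [])
  compile (runE c t as)  = Cp (clockedC c) (compile t ∷ compileAll as)
  compile (prodE b body) = Cp (prodBelowC (compile body)) (compile b ∷ tabulate Pj)

  compileAll : ∀ {n k} → Vec (Expr n) k → Vec (PR n) k
  compileAll []       = []
  compileAll (a ∷ as) = compile a ∷ compileAll as

mutual
  ev-compile : ∀ {A n} (e : Expr n) xs → Ev A (compile e) xs (evalE A e xs)
  ev-compile (var i)        xs = ev-Pj
  ev-compile (lit c)        xs = ev-const c
  ev-compile (a ⊕ b)        xs = ev-Cp₂ (ev-compile a xs) (ev-compile b xs) (ev-add _ _)
  ev-compile (a ⊖ b)        xs = ev-Cp₂ (ev-compile a xs) (ev-compile b xs) (ev-monus _ _)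
  ev-compile (a ⊗ b)        xs = ev-Cp₂ (ev-compile a xs) (ev-compile b xs) (ev-mul _ _)
  ev-compile (pow2E a)      xs = ev-Cp₁ (ev-compile a xs) (ev-pow2 _)
  ev-compile (triE a)       xs = ev-Cp₁ (ev-compile a xs) (ev-tri _)
  ev-compile (distE a b)    xs = ev-Cp₂ (ev-compile a xs) (ev-compile b xs) (ev-dist _ _)
  ev-compile (runE c t as)  xs = ev-Cp (evv-∷ (ev-compile t xs) (evv-compileAll as xs)) (ev-clocked c _ _)
  ev-compile {A} (prodE b body) xs =
    ev-Cp (evv-∷ (ev-compile b xs) (subst (EvV A (tabulate Pj) xs) (tabulate∘lookup xs) (evv-tabulate id)))
          (ev-prodBelow (compile body) (λ z → evalE A body (z ∷ xs)) (λ z → ev-compile body (z ∷ xs)) _)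

  evv-compileAll : ∀ {A n k} (as : Vec (Expr n) k) xs → EvV A (compileAll as) xs (evalEs A as xs)
  evv-compileAll []       xs = evv-[]
  evv-compileAll (a ∷ as) xs = evv-∷ (ev-compile a xs) (evv-compileAll as xs)

inc : List Bool → List Bool
inc []          = false ∷ []
inc (false ∷ s) = true ∷ s
inc (true ∷ s)  = false ∷ inc s

enc-inc : ∀ s → enc (inc s) ≡ suc (enc s)
enc-inc []          = refl
enc-inc (false ∷ s) = refl
enc-inc (true ∷ s) rewrite enc-inc s | *-suc 2 (enc s) = refl

decode : ℕ → List Bool
decode zero    = []
decode (suc n) = inc (decode n)

enc-decode : ∀ n → enc (decode n) ≡ n
enc-decode zero = refl
enc-decode (suc n) rewrite enc-inc (decode n) | enc-decode n = refl

suc-enc-false∷ : ∀ s → suc (enc (false ∷ s)) ≡ 2 * suc (enc s)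
suc-enc-false∷ s = sym (*-suc 2 (enc s))

enc-bounds : ∀ p → 2 ^ length p ≤ suc (enc p) × suc (enc p) < 2 ^ suc (length p)
enc-bounds []          = s≤s z≤n , s≤s (s≤s z≤n)
enc-bounds (b ∷ s) with enc-bounds s
... | lower , upper = lower′ b , upper′ b
  where
  doubled-lower : 2 ^ suc (length s) ≤ suc (enc (false ∷ s))
  doubled-lower = subst (2 ^ suc (length s) ≤_) (sym (suc-enc-false∷ s)) (*-monoʳ-≤ 2 lower)
  doubled-upper : suc (suc (suc (enc (false ∷ s)))) ≤ 2 ^ suc (suc (length s))
  doubled-upper =
    subst (_≤ 2 ^ suc (suc (length s))) (trans (*-suc 2 (suc (enc s))) (cong (2 +_) (sym (suc-enc-false∷ s)))) (*-monoʳ-≤ 2 upper)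
  lower′ : ∀ b → 2 ^ length (b ∷ s) ≤ suc (enc (b ∷ s))
  lower′ false = doubled-lower
  lower′ true  = ≤-trans doubled-lower (n≤1+n _)
  upper′ : ∀ b → suc (enc (b ∷ s)) < 2 ^ suc (length (b ∷ s))
  upper′ false = ≤-trans (n≤1+n _) doubled-upper
  upper′ true  = doubled-upper

length<⇒ : ∀ p y → length p < y → suc (enc p) < 2 ^ y
length<⇒ p y |p|<y = <-≤-trans (proj₂ (enc-bounds p)) (^-monoʳ-≤ 2 |p|<y)

⇒length< : ∀ p y → suc (enc p) < 2 ^ y → length p < y
⇒length< p y <2^y with y ≤? length p
... | no  y≰|p| = ≰⇒> y≰|p|
... | yes y≤|p| = ⊥-elim (<-irrefl refl (<-≤-trans <2^y (≤-trans (^-monoʳ-≤ 2 y≤|p|) (proj₁ (enc-bounds p)))))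

long-string : ∀ m → Σ (List Bool) λ p → m + length p < enc p
long-string zero    = false ∷ false ∷ [] , s≤s (s≤s (s≤s z≤n))
long-string (suc m) with long-string m
... | p , m+|p|<enc = false ∷ p , s≤s (begin-strict
  m + suc (length p)   ≡⟨ +-suc m (length p) ⟩
  suc (m + length p)   <⟨ s≤s m+|p|<enc ⟩
  suc (enc p)          ≡⟨ +-comm 1 (enc p) ⟩
  enc p + 1            ≤⟨ +-monoʳ-≤ (enc p) (≤-trans (s≤s z≤n) m+|p|<enc) ⟩
  enc p + enc p        ≡⟨ cong (enc p +_) (sym (+-identityʳ (enc p))) ⟩
  2 * enc p            ∎)
  where open ≤-Reasoning

n≤tri : ∀ n → n ≤ tri n
n≤tri zero    = z≤n
n≤tri (suc n) = m≤m+n (suc n) (tri n)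

m≤⟨m,n⟩ : ∀ m n → m ≤ ⟨ m , n ⟩
m≤⟨m,n⟩ m n = ≤-trans (≤-trans (m≤m+n m n) (n≤tri (m + n))) (m≤m+n _ n)

n≤⟨m,n⟩ : ∀ m n → n ≤ ⟨ m , n ⟩
n≤⟨m,n⟩ m n = m≤n+m n (tri (m + n))

tri-mono-≤ : ∀ {a b} → a ≤ b → tri a ≤ tri b
tri-mono-≤ z≤n       = z≤n
tri-mono-≤ (s≤s a≤b) = +-mono-≤ (s≤s a≤b) (tri-mono-≤ a≤b)

-- tri s + b is the code of a pair on diagonal s, so it lies strictly below diagonal s′ > s.
tri+<tri : ∀ {s s′ b} → s < s′ → b ≤ s → tri s + b < tri s′
tri+<tri {s} {suc s′} {b} (s≤s s≤s′) b≤s = begin-strict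
  tri s + b         ≤⟨ +-monoʳ-≤ (tri s) b≤s ⟩
  tri s + s         <⟨ s≤s (≤-reflexive (+-comm (tri s) s)) ⟩
  suc (s + tri s)   ≤⟨ s≤s (+-mono-≤ s≤s′ (tri-mono-≤ s≤s′)) ⟩
  tri (suc s′)      ∎
  where open ≤-Reasoning

⟨,⟩-injective : ∀ a b c d → ⟨ a , b ⟩ ≡ ⟨ c , d ⟩ → a ≡ c × b ≡ d
⟨,⟩-injective a b c d e with <-cmp (a + b) (c + d)
... | tri< lt _ _ = ⊥-elim (<⇒≢ (<-≤-trans (tri+<tri lt (m≤n+m b a)) (m≤m+n _ d)) e)
... | tri> _ _ gt = ⊥-elim (<⇒≢ (<-≤-trans (tri+<tri gt (m≤n+m d c)) (m≤m+n _ b)) (sym e))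
... | tri≈ _ a+b≡c+d _ = a≡c , b≡d
  where
  b≡d : b ≡ d
  b≡d = +-cancelˡ-≡ (tri (c + d)) b d (subst (λ s → tri s + b ≡ tri (c + d) + d) a+b≡c+d e)
  a≡c : a ≡ c
  a≡c = +-cancelʳ-≡ b a c (subst (λ z → a + b ≡ c + z) (sym b≡d) a+b≡c+d)

unbounded⇒infinite : {S : ℕ → Set} {R : ℕ → ℕ → Set} →
                     (∀ {x y y′} → R x y → R x y′ → y ≡ y′) →
                     (∀ B → ∃ λ x → S x × ∃ λ y → R x y × B < y) → Infinite S
unbounded⇒infinite {S} {R} functional unbounded m = let (x , m≤x , Sx , _) = beyond m 0 in x , m≤x , Sx
  where
  beyond : ∀ m B → ∃ λ x → m ≤ x × S x × ∃ λ y → R x y × B < y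
  beyond zero B = let (x , Sx , rest) = unbounded B in x , z≤n , Sx , rest
  beyond (suc m) B with beyond m B
  ... | x , m≤x , Sx , y , Rxy , B<y with m≤n⇒m<n∨m≡n m≤x
  ... | inj₁ m<x  = x , m<x , Sx , y , Rxy , B<y
  ... | inj₂ refl with beyond m (B ⊔ y)
  ... | x′ , m≤x′ , Sx′ , y′ , Rx′y′ , B⊔y<y′ with m≤n⇒m<n∨m≡n m≤x′
  ... | inj₁ m<x′ = x′ , m<x′ , Sx′ , y′ , Rx′y′ , ≤-<-trans (m≤m⊔n B y) B⊔y<y′
  ... | inj₂ refl = ⊥-elim (<-irrefl (functional Rxy Rx′y′) (≤-<-trans (m≤n⊔m B y) B⊔y<y′))

Halts : Oracle → PR 1 → ℕ → Set
Halts A c x = ∃ λ y → Ev A c (x ∷ []) y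

OptimalAt : Oracle → PR 1 → Set
OptimalAt A u = ∀ (g : PR 1) → Σ ℕ λ c → ∀ p x → Ev A g (enc p ∷ []) x →
                Σ (List Bool) λ q → Ev A u (enc q ∷ []) x × length q ≤ length p + c

clocked-pos-sound : ∀ {A n} (c : PR n) t xs → 1 ≤ clocked A c t xs → Ev A c xs (clocked A c t xs ∸ 1)
clocked-pos-sound {A} c t xs 1≤ with clocked A c t xs in eq
... | suc y = clocked-sound c t xs y eq

∃-⇔ : {P Q : ℕ → Set} → (∀ y → P y ⇔ Q y) → ∃ P ⇔ ∃ Q
∃-⇔ P⇔Q = mk⇔ (map₂ λ {y} → Equivalence.to (P⇔Q y)) (map₂ λ {y} → Equivalence.from (P⇔Q y))

Halts-Cp₁ : ∀ {A} (c g : PR 1) {h : ℕ → ℕ} → (∀ x → Ev A g (x ∷ []) (h x)) →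
            ∀ x → Halts A (Cp c (g ∷ [])) x ⇔ Halts A c (h x)
Halts-Cp₁ {A} c g {h} g-computes x = mk⇔ to′ (map₂ (ev-Cp₁ (g-computes x)))
  where
  to′ : Halts A (Cp c (g ∷ [])) x → Halts A c (h x)
  to′ (r , ev-Cp (evv-∷ ev-g evv-[]) ev-c) = r , subst (λ a → Ev A c (a ∷ []) r) (Ev-functional ev-g (g-computes x)) ev-c

smn-Computable₁ : {s : ℕ → ℕ → ℕ} → Computable₂ s → ∀ e → Computable₁ (s e)
smn-Computable₁ (sc , s-computes) e = Cp sc (constC e ∷ Pj zero ∷ []) , λ x → ev-Cp₂ (ev-const e) ev-Pj (s-computes e x)

smn-Computable₂ : {s : ℕ → ℕ → ℕ} → Computable₂ s → ∀ e → Computable₂ (λ i j → s (s e i) j)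
smn-Computable₂ {s} (sc , s-computes) e =
  Cp sc (Cp sc (constC e ∷ Pj (# 0) ∷ []) ∷ Pj (# 1) ∷ []) ,
  λ i j → ev-Cp₂ (ev-Cp₂ (ev-const e) ev-Pj (s-computes e i)) ev-Pj (s-computes (s e i) j)

-- uW (j , x) halts iff x ∈ W_j, uφ (i , x) computes φ_i(x), and U is the machine defining K.
module Construction (uW uφ : PR 2) (U : PR 1) where

  Dom : Oracle → ℕ → ℕ → Set
  Dom A j x = ∃ λ w → Ev A uW (j ∷ x ∷ []) w

  KBelow : Oracle → ℕ → ℕ → Set
  KBelow A i x = ∃ λ y → Ev A uφ (i ∷ x ∷ []) y × KA< U A x y

  Large : Oracle → ℕ → ℕ → ℕ → ℕ → Set
  Large A i j n x = Dom A j x × ∃ λ y → Ev A uφ (i ∷ x ∷ []) y × n < y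

  -- c is the clocked value suc y of φ_i(x); 2 + q ≤ 2 ^ y says |decode q| < y.
  kWitness : Oracle → ℕ → ℕ → ℕ → ℕ → ℕ
  kWitness A t x c q = ∣ clocked A U t (q ∷ []) - suc x ∣ + (2 + q ∸ 2 ^ (c ∸ 1))

  kTest : Oracle → ℕ → ℕ → ℕ → ℕ
  kTest A t i x = (1 ∸ clocked A uφ t (i ∷ x ∷ [])) + prodBelow (kWitness A t x (clocked A uφ t (i ∷ x ∷ []))) t

  kTestE : ∀ {n} → Fin n → Fin n → Fin n → Expr n
  kTestE t i x =
    (lit 1 ⊖ runE uφ (var t) (var i ∷ var x ∷ [])) ⊕
    prodE (var t) (distE (runE U (var (suc t)) (var zero ∷ [])) (lit 1 ⊕ var (suc x)) ⊕
                   ((lit 2 ⊕ var zero) ⊖ pow2E (runE uφ (var (suc t)) (var (suc i) ∷ var (suc x) ∷ []) ⊖ lit 1)))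

  kTest-sound : ∀ A t i x → kTest A t i x ≡ 0 → KBelow A i x
  kTest-sound A t i x kTest≡0 = y , clocked-pos-sound uφ t _ (m∸n≡0⇒m≤n (m+n≡0⇒m≡0 _ kTest≡0)) , decode q , ev-U , short
    where
    c : ℕ
    c = clocked A uφ t (i ∷ x ∷ [])
    y : ℕ
    y = c ∸ 1
    witness : ∃ λ q → q < t × kWitness A t x c q ≡ 0
    witness = prodBelow≡0⇒ _ t (m+n≡0⇒n≡0 _ kTest≡0)
    q : ℕ
    q = proj₁ witness
    ev-U : Ev A U (enc (decode q) ∷ []) x
    ev-U = subst (λ z → Ev A U (z ∷ []) x) (sym (enc-decode q))
                 (clocked-sound U t (q ∷ []) x (∣m-n∣≡0⇒m≡n (m+n≡0⇒m≡0 _ (proj₂ (proj₂ witness)))))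
    short : length (decode q) < y
    short = ⇒length< (decode q) y
      (subst (λ z → 2 + z ≤ 2 ^ y) (sym (enc-decode q)) (m∸n≡0⇒m≤n (m+n≡0⇒n≡0 _ (proj₂ (proj₂ witness)))))

  kTest-complete : ∀ {A i x} → KBelow A i x → ∃ λ t₀ → ∀ t → t₀ ≤ t → kTest A t i x ≡ 0
  kTest-complete {A} {i} {x} (y , ev-φ , p , ev-U , |p|<y) with clocked-complete ev-φ | clocked-complete ev-U
  ... | t₁ , clocked-φ | t₂ , clocked-U = t₁ ⊔ t₂ ⊔ suc (enc p) , zero-after
    where
    zero-after : ∀ t → t₁ ⊔ t₂ ⊔ suc (enc p) ≤ t → kTest A t i x ≡ 0
    zero-after t t₀≤t
      rewrite clocked-mono uφ _ y (≤-trans (m≤n⇒m≤n⊔o (suc (enc p)) (m≤m⊔n t₁ t₂)) t₀≤t) clocked-φ | 0∸n≡0 y =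
      prodBelow-zero _ (enc p) (≤-trans (m≤n⊔m (t₁ ⊔ t₂) (suc (enc p))) t₀≤t) witness
      where
      witness : kWitness A t x (suc y) (enc p) ≡ 0
      witness = cong₂ _+_
        (trans (cong (∣_- suc x ∣) (clocked-mono U _ x (≤-trans (m≤n⇒m≤n⊔o (suc (enc p)) (m≤n⊔m t₁ t₂)) t₀≤t) clocked-U))
               (∣n-n∣≡0 (suc x)))
        (m≤n⇒m∸n≡0 (length<⇒ p y |p|<y))

  lowTestAt : Oracle → ℕ → ℕ → ℕ → ℕ → ℕ
  lowTestAt A t w i x = ∣ ⟨ i , x ⟩ - w ∣ + kTest A t i x

  lowTest : Oracle → ℕ → ℕ → ℕ
  lowTest A t w = prodBelow (λ i → prodBelow (lowTestAt A t w i) (suc w)) (suc w)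

  lowTestE : Expr 2
  lowTestE = prodE (lit 1 ⊕ var (# 1)) (prodE (lit 1 ⊕ var (# 2))
               (distE (pairE (var (# 1)) (var (# 0))) (var (# 3)) ⊕ kTestE (# 2) (# 1) (# 0)))

  opaque
    lowTestC : PR 2
    lowTestC = compile lowTestE

    ev-lowTest : ∀ {A} t w → Ev A lowTestC (t ∷ w ∷ []) (lowTest A t w)
    ev-lowTest t w = ev-compile lowTestE (t ∷ w ∷ [])

  lowC : PR 1
  lowC = Mu lowTestC

  lowC-sound : ∀ {A w r} → Ev A lowC (w ∷ []) r → ∃ λ i → ∃ λ x → ⟨ i , x ⟩ ≡ w × KBelow A i x
  lowC-sound {A} {w} {r} ev
    with prodBelow≡0⇒ (λ i → prodBelow (lowTestAt A r w i) (suc w)) (suc w)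
                      (Mu-total-zero lowTestC (λ t → lowTest A t w) (λ t → ev-lowTest t w) ev)
  ... | i , _ , found-i with prodBelow≡0⇒ (lowTestAt A r w i) (suc w) found-i
  ... | x , _ , found-x =
    i , x , ∣m-n∣≡0⇒m≡n (m+n≡0⇒m≡0 ∣ ⟨ i , x ⟩ - w ∣ found-x) ,
    kTest-sound A r i x (m+n≡0⇒n≡0 ∣ ⟨ i , x ⟩ - w ∣ found-x)

  lowC-complete : ∀ {A i x} → KBelow A i x → Halts A lowC ⟨ i , x ⟩
  lowC-complete {A} {i} {x} below with kTest-complete below
  ... | t₀ , kTest≡0 =
    let (r , _ , ev) = ev-Mu-total lowTestC (λ t → lowTest A t ⟨ i , x ⟩) (λ t → ev-lowTest t _) t₀ lowTest≡0
    in r , ev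
    where
    lowTest≡0 : lowTest A t₀ ⟨ i , x ⟩ ≡ 0
    lowTest≡0 = prodBelow-zero (λ i′ → prodBelow (lowTestAt A t₀ ⟨ i , x ⟩ i′) (suc ⟨ i , x ⟩)) i (s≤s (m≤⟨m,n⟩ i x))
                  (prodBelow-zero (lowTestAt A t₀ ⟨ i , x ⟩ i) x (s≤s (n≤⟨m,n⟩ i x))
                  (cong₂ _+_ (∣n-n∣≡0 ⟨ i , x ⟩) (kTest≡0 t₀ ≤-refl)))

  lowC-halts : ∀ {A i x} → Halts A lowC ⟨ i , x ⟩ ⇔ KBelow A i x
  lowC-halts {A} {i} {x} = mk⇔ sound lowC-complete
    where
    sound : Halts A lowC ⟨ i , x ⟩ → KBelow A i x
    sound (_ , ev) =
      let (i′ , x′ , ⟨i′,x′⟩≡⟨i,x⟩ , below) = lowC-sound ev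
          (i′≡i , x′≡x) = ⟨,⟩-injective i′ x′ i x ⟨i′,x′⟩≡⟨i,x⟩
      in subst₂ (KBelow A) i′≡i x′≡x below

  largeTest : Oracle → ℕ → ℕ → ℕ → ℕ → ℕ → ℕ
  largeTest A t i j n x = (1 ∸ clocked A uW t (j ∷ x ∷ [])) + (2 + n ∸ clocked A uφ t (i ∷ x ∷ []))

  largeTestE : Expr 5
  largeTestE = (lit 1 ⊖ runE uW (var (# 1)) (var (# 3) ∷ var (# 0) ∷ [])) ⊕
               ((lit 2 ⊕ var (# 4)) ⊖ runE uφ (var (# 1)) (var (# 2) ∷ var (# 0) ∷ []))

  largeTest-sound : ∀ A t i j n x → largeTest A t i j n x ≡ 0 → Large A i j n x
  largeTest-sound A t i j n x largeTest≡0 =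
    (_ , clocked-pos-sound uW t _ (m∸n≡0⇒m≤n (m+n≡0⇒m≡0 _ largeTest≡0))) ,
    _ , clocked-pos-sound uφ t _ (≤-trans (s≤s z≤n) 2+n≤c) , ∸-monoˡ-≤ 1 2+n≤c
    where
    2+n≤c : 2 + n ≤ clocked A uφ t (i ∷ x ∷ [])
    2+n≤c = m∸n≡0⇒m≤n (m+n≡0⇒n≡0 (1 ∸ clocked A uW t (j ∷ x ∷ [])) largeTest≡0)

  largeTest-complete : ∀ {A i j n x} → Large A i j n x → ∃ λ t → x < t × largeTest A t i j n x ≡ 0
  largeTest-complete {A} {i} {j} {n} {x} ((w , ev-W) , y , ev-φ , n<y) with clocked-complete ev-W | clocked-complete ev-φ
  ... | t₁ , clocked-W | t₂ , clocked-φ = t , m≤n⊔m (t₁ ⊔ t₂) (suc x) , zero-at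
    where
    t : ℕ
    t = t₁ ⊔ t₂ ⊔ suc x
    zero-at : largeTest A t i j n x ≡ 0
    zero-at rewrite clocked-mono uW _ w (m≤n⇒m≤n⊔o (suc x) (m≤m⊔n t₁ t₂)) clocked-W
                  | clocked-mono uφ _ y (m≤n⇒m≤n⊔o (suc x) (m≤n⊔m t₁ t₂)) clocked-φ
                  | 0∸n≡0 w = m≤n⇒m∸n≡0 (s≤s n<y)

  timeTestE : Expr 4
  timeTestE = prodE (var (# 0)) largeTestE

  opaque
    largeTestC : PR 5
    largeTestC = compile largeTestE

    ev-largeTest : ∀ {A} x t i j n → Ev A largeTestC (x ∷ t ∷ i ∷ j ∷ n ∷ []) (largeTest A t i j n x)
    ev-largeTest x t i j n = ev-compile largeTestE (x ∷ t ∷ i ∷ j ∷ n ∷ [])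

    timeTestC : PR 4
    timeTestC = compile timeTestE

    ev-timeTest : ∀ {A} t i j n → Ev A timeTestC (t ∷ i ∷ j ∷ n ∷ []) (prodBelow (largeTest A t i j n) t)
    ev-timeTest t i j n = ev-compile timeTestE (t ∷ i ∷ j ∷ n ∷ [])

  -- firstC (i , j , n) is the first x found, by dovetailing, in W_j with φ_i(x) > n.
  firstC : PR 3
  firstC = Cp (Mu largeTestC) (Mu timeTestC ∷ Pj (# 0) ∷ Pj (# 1) ∷ Pj (# 2) ∷ [])

  firstC-sound : ∀ {A i j n x} → Ev A firstC (i ∷ j ∷ n ∷ []) x → Large A i j n x
  firstC-sound {A} {i} {j} {n} {x} (ev-Cp (evv-∷ {y = T} _ (evv-∷ ev-Pj (evv-∷ ev-Pj (evv-∷ ev-Pj evv-[])))) ev-x) =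
    largeTest-sound A T i j n x (Mu-total-zero largeTestC (largeTest A T i j n) (λ z → ev-largeTest z T i j n) ev-x)

  firstC-total : ∀ {A i j n x₀} → Large A i j n x₀ → ∃ λ x → Ev A firstC (i ∷ j ∷ n ∷ []) x
  firstC-total {A} {i} {j} {n} {x₀} large with largeTest-complete large
  ... | t , x₀<t , largeTest≡0
    with ev-Mu-total timeTestC (λ T → prodBelow (largeTest A T i j n) T) (λ T → ev-timeTest T i j n) t
                     (prodBelow-zero (largeTest A t i j n) x₀ x₀<t largeTest≡0)
  ... | T , timeTest≡0 , ev-T with prodBelow≡0⇒ (largeTest A T i j n) T timeTest≡0
  ... | x′ , _ , largeTest′≡0 with ev-Mu-total largeTestC (largeTest A T i j n) (λ z → ev-largeTest z T i j n) x′ largeTest′≡0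
  ... | x , _ , ev-x = x , ev-Cp (evv-∷ ev-T (evv-∷ ev-Pj (evv-∷ ev-Pj (evv-∷ ev-Pj evv-[])))) ev-x

  denseTestAt : Oracle → ℕ → ℕ → ℕ → ℕ → ℕ → ℕ
  denseTestAt A t w i j x =
    ∣ ⟨ i , ⟨ j , x ⟩ ⟩ - w ∣ + prodBelow (λ n → ∣ clocked A firstC t (i ∷ j ∷ n ∷ []) - suc x ∣ + kTest A t i x) t

  denseTest : Oracle → ℕ → ℕ → ℕ
  denseTest A t w = prodBelow (λ i → prodBelow (λ j → prodBelow (denseTestAt A t w i j) (suc w)) (suc w)) (suc w)

  denseTestE : Expr 2
  denseTestE =
    prodE (lit 1 ⊕ var (# 1)) (prodE (lit 1 ⊕ var (# 2)) (prodE (lit 1 ⊕ var (# 3))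
      (distE (pairE (var (# 2)) (pairE (var (# 1)) (var (# 0)))) (var (# 4)) ⊕
       prodE (var (# 3)) (distE (runE firstC (var (# 4)) (var (# 3) ∷ var (# 2) ∷ var (# 0) ∷ [])) (lit 1 ⊕ var (# 1)) ⊕
                          kTestE (# 4) (# 3) (# 1)))))

  opaque
    denseTestC : PR 2
    denseTestC = compile denseTestE

    ev-denseTest : ∀ {A} t w → Ev A denseTestC (t ∷ w ∷ []) (denseTest A t w)
    ev-denseTest t w = ev-compile denseTestE (t ∷ w ∷ [])

  denseC : PR 1
  denseC = Mu denseTestC

  denseC-sound : ∀ {A w r} → Ev A denseC (w ∷ []) r →
                 ∃ λ i → ∃ λ j → ∃ λ x → ⟨ i , ⟨ j , x ⟩ ⟩ ≡ w × Dom A j x × KBelow A i x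
  denseC-sound {A} {w} {r} ev
    with prodBelow≡0⇒ (λ i → prodBelow (λ j → prodBelow (denseTestAt A r w i j) (suc w)) (suc w)) (suc w)
                      (Mu-total-zero denseTestC (λ t → denseTest A t w) (λ t → ev-denseTest t w) ev)
  ... | i , _ , found-i with prodBelow≡0⇒ (λ j → prodBelow (denseTestAt A r w i j) (suc w)) (suc w) found-i
  ... | j , _ , found-j with prodBelow≡0⇒ (denseTestAt A r w i j) (suc w) found-j
  ... | x , _ , found-x
    with prodBelow≡0⇒ (λ n → ∣ clocked A firstC r (i ∷ j ∷ n ∷ []) - suc x ∣ + kTest A r i x) r
                      (m+n≡0⇒n≡0 ∣ ⟨ i , ⟨ j , x ⟩ ⟩ - w ∣ found-x)
  ... | n , _ , found-n =
    i , j , x , ∣m-n∣≡0⇒m≡n (m+n≡0⇒m≡0 ∣ ⟨ i , ⟨ j , x ⟩ ⟩ - w ∣ found-x) ,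
    proj₁ (firstC-sound (clocked-sound firstC r _ x
      (∣m-n∣≡0⇒m≡n (m+n≡0⇒m≡0 ∣ clocked A firstC r (i ∷ j ∷ n ∷ []) - suc x ∣ found-n)))) ,
    kTest-sound A r i x (m+n≡0⇒n≡0 ∣ clocked A firstC r (i ∷ j ∷ n ∷ []) - suc x ∣ found-n)

  denseC-complete : ∀ {A i j n x} → Ev A firstC (i ∷ j ∷ n ∷ []) x → KBelow A i x → Halts A denseC ⟨ i , ⟨ j , x ⟩ ⟩
  denseC-complete {A} {i} {j} {n} {x} ev-F below with clocked-complete ev-F | kTest-complete below
  ... | t₁ , clocked-F | t₂ , kTest≡0 =
    let (r , _ , ev) = ev-Mu-total denseTestC (λ t → denseTest A t w) (λ t → ev-denseTest t w) T denseTest≡0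
    in r , ev
    where
    w T : ℕ
    w = ⟨ i , ⟨ j , x ⟩ ⟩
    T = t₁ ⊔ t₂ ⊔ suc n
    found-n : ∣ clocked A firstC T (i ∷ j ∷ n ∷ []) - suc x ∣ + kTest A T i x ≡ 0
    found-n = cong₂ _+_
      (trans (cong (∣_- suc x ∣) (clocked-mono firstC _ x (m≤n⇒m≤n⊔o (suc n) (m≤m⊔n t₁ t₂)) clocked-F))
             (∣n-n∣≡0 (suc x)))
      (kTest≡0 T (m≤n⇒m≤n⊔o (suc n) (m≤n⊔m t₁ t₂)))
    denseTest≡0 : denseTest A T w ≡ 0
    denseTest≡0 =
      prodBelow-zero (λ i′ → prodBelow (λ j′ → prodBelow (denseTestAt A T w i′ j′) (suc w)) (suc w)) i
        (s≤s (m≤⟨m,n⟩ i _))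
        (prodBelow-zero (λ j′ → prodBelow (denseTestAt A T w i j′) (suc w)) j
          (s≤s (≤-trans (m≤⟨m,n⟩ j x) (n≤⟨m,n⟩ i _)))
          (prodBelow-zero (denseTestAt A T w i j) x
            (s≤s (≤-trans (n≤⟨m,n⟩ j x) (n≤⟨m,n⟩ i _)))
            (cong₂ _+_ (∣n-n∣≡0 w)
              (prodBelow-zero (λ n′ → ∣ clocked A firstC T (i ∷ j ∷ n′ ∷ []) - suc x ∣ + kTest A T i x) n
                (m≤n⊔m (t₁ ⊔ t₂) (suc n)) found-n))))

  denseC-sound-at : ∀ {A i j x} → Halts A denseC ⟨ i , ⟨ j , x ⟩ ⟩ → Dom A j x × KBelow A i x
  denseC-sound-at {A} {i} {j} {x} (_ , ev) =
    let (i′ , j′ , x′ , eq , dom , below) = denseC-sound ev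
        (i′≡i , ⟨j′,x′⟩≡⟨j,x⟩) = ⟨,⟩-injective i′ _ i _ eq
        (j′≡j , x′≡x) = ⟨,⟩-injective j′ x′ j x ⟨j′,x′⟩≡⟨j,x⟩
    in subst₂ (Dom A) j′≡j x′≡x dom , subst₂ (KBelow A) i′≡i x′≡x below

  denseC-unbounded : ∀ {A i j} → OptimalAt A U → (∀ n → ∃ λ x → Large A i j n x) →
                     ∀ B → ∃ λ x → Halts A denseC ⟨ i , ⟨ j , x ⟩ ⟩ × ∃ λ y → Ev A uφ (i ∷ x ∷ []) y × B < y
  denseC-unbounded {A} {i} {j} optimal large B with optimal (Cp firstC (constC i ∷ constC j ∷ Pj zero ∷ []))
  ... | c , compress with long-string (B + c)
  ... | p , B+c+|p|<enc with firstC-total (proj₂ (large (enc p)))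
  ... | x , ev-F with firstC-sound ev-F | compress p x (ev-Cp₃ (ev-const i) (ev-const j) ev-Pj ev-F)
  ... | _ , y , ev-φ , enc<y | q , ev-U , |q|≤|p|+c =
    x , denseC-complete ev-F (y , ev-φ , q , ev-U , |q|<y) , y , ev-φ , B<y
    where
    |p|+c<y : length p + c < y
    |p|+c<y = begin-strict
      length p + c         ≡⟨ +-comm (length p) c ⟩
      c + length p         ≤⟨ +-monoˡ-≤ (length p) (m≤n+m c B) ⟩
      B + c + length p     <⟨ B+c+|p|<enc ⟩
      enc p                <⟨ enc<y ⟩
      y                    ∎
      where open ≤-Reasoning
    |q|<y : length q < y
    |q|<y = ≤-<-trans |q|≤|p|+c |p|+c<y
    B<y : B < y
    B<y = ≤-<-trans (≤-trans (m≤m+n B c) (m≤m+n (B + c) (length p))) (<-trans B+c+|p|<enc enc<y)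

  denseC-infinite : ∀ {A i j} → OptimalAt A U → (∀ n → ∃ λ x → Large A i j n x) →
                    Infinite (λ x → Halts A denseC ⟨ i , ⟨ j , x ⟩ ⟩)
  denseC-infinite optimal large = unbounded⇒infinite Ev-functional (denseC-unbounded optimal large)

  KBelow-via : ∀ {A} {G : ℕ → ℕ → ℕ → Set} → (∀ i x y → G i x y ⇔ Ev A uφ (i ∷ x ∷ []) y) →
               ∀ i x → (∃ λ y → G i x y × KA< U A x y) ⇔ KBelow A i x
  KBelow-via G⇔ i x = ∃-⇔ λ y → mk⇔ (map₁ (Equivalence.to (G⇔ i x y))) (map₁ (Equivalence.from (G⇔ i x y)))

  module Indexed {D : ℕ → ℕ → Set} {A : Oracle} {s : ℕ → ℕ → ℕ} {e₁ e₂ : ℕ}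
                 (smn : ∀ i z x → D (s i z) x ⇔ D i ⟨ z , x ⟩)
                 (index-low : ∀ w → D e₁ w ⇔ Halts A lowC w)
                 (index-dense : ∀ w → D e₂ w ⇔ Halts A denseC w) where

    ξ-correct : ∀ i x → D (s e₁ i) x ⇔ KBelow A i x
    ξ-correct i x = ⇔-trans (smn e₁ i x) (⇔-trans (index-low ⟨ i , x ⟩) lowC-halts)

    θ-halts : ∀ i j x → D (s (s e₂ i) j) x ⇔ Halts A denseC ⟨ i , ⟨ j , x ⟩ ⟩
    θ-halts i j x = ⇔-trans (smn (s e₂ i) j x) (⇔-trans (smn e₂ i ⟨ j , x ⟩) (index-dense _))

    θ-sound : ∀ i j x → D (s (s e₂ i) j) x → Dom A j x × KBelow A i x
    θ-sound i j x = denseC-sound-at ∘ Equivalence.to (θ-halts i j x)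

    θ-infinite : ∀ {i j} → OptimalAt A U → (∀ n → ∃ λ x → Large A i j n x) → Infinite (D (s (s e₂ i) j))
    θ-infinite {i} {j} optimal large m =
      let (x , m≤x , halts) = denseC-infinite optimal large m in x , m≤x , Equivalence.from (θ-halts i j x) halts

uniform : ∀ (U : PR 1) → Optimal U →
  ∀ (φ : ℕ → ℕ → ℕ → Set) (W : ℕ → ℕ → Set) → AcceptablePR φ → AcceptableRE W →
  Σ (ℕ → ℕ) λ ξ → Σ (ℕ → ℕ → ℕ) λ θ → Computable₁ ξ × Computable₂ θ ×
    (∀ i x → (∃ λ y → φ i x y × Klt U x y) ⇔ W (ξ i) x)
    × (∀ i j → (∀ n → ∃ λ x → ∃ λ y → W j x × φ i x y × n < y) →
         Infinite (W (θ i j))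
         × (∀ x → W (θ i j) x → W j x × (∃ λ y → φ i x y × Klt U x y)))
uniform U optimal φ W ((uφ , uφ-universal) , _ , _) ((uW , uW-universal) , index , (s , s-computable , smn)) =
  s e₁ , (λ i j → s (s e₂ i) j) , smn-Computable₁ s-computable e₁ , smn-Computable₂ s-computable e₂ ,
  (λ i x → ⇔-trans (KBelow-via uφ-universal i x) (⇔-sym (ξ-correct i x))) ,
  λ i j unbounded →
    θ-infinite optimal (λ n → let (x , y , w , φy , n<y) = unbounded n in
                              x , Equivalence.to (uW-universal j x) w , y , Equivalence.to (uφ-universal i x y) φy , n<y) ,
    λ x w → let (dom , below) = θ-sound i j x w in
            Equivalence.from (uW-universal j x) dom , Equivalence.from (KBelow-via uφ-universal i x) below
  where
  open Construction uW uφ U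
  e₁ e₂ : ℕ
  e₁ = proj₁ (index lowC)
  e₂ = proj₁ (index denseC)
  open Indexed {D = W} {A = ∅} smn (proj₂ (index lowC)) (proj₂ (index denseC))

dense : ∀ (U : PR 1) → Optimal U →
  ∀ (φ : ℕ → ℕ) → Computable₁ φ → TendsToInfinity φ →
  ∀ (W : ℕ → ℕ → Set) → AcceptableRE W →
  RE (λ x → Klt U x (φ x)) × ConstructivelyDense W (λ x → Klt U x (φ x))
dense U optimal φ (φc , φc-computes) tends W ((uW , uW-universal) , index , (s , s-computable , smn)) =
  (Cp lowC (pair₀C ∷ []) ,
   λ x → ⇔-sym (⇔-trans (Halts-Cp₁ lowC pair₀C (λ x → ev-compile (pairE (lit 0) (var zero)) (x ∷ [])) x)
                        (⇔-trans lowC-halts (KBelow⇔ 0 x)))) ,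
  (λ i → s (s e₂ 0) i) , smn-Computable₁ s-computable (s e₂ 0) ,
  λ i infinite →
    θ-infinite optimal (λ n → let (m , large-φ) = tends (suc n) ; (x , m≤x , w) = infinite m in
                              x , Equivalence.to (uW-universal i x) w , φ x , ev-uφ 0 x , large-φ x m≤x) ,
    λ x w → let (dom , below) = θ-sound 0 i x w in
            Equivalence.to (KBelow⇔ 0 x) below , Equivalence.from (uW-universal i x) dom
  where
  uφ : PR 2
  uφ = Cp φc (Pj (# 1) ∷ [])
  ev-uφ : ∀ i x → Ev ∅ uφ (i ∷ x ∷ []) (φ x)
  ev-uφ i x = ev-Cp₁ ev-Pj (φc-computes x)
  open Construction uW uφ U
  KBelow⇔ : ∀ i x → KBelow ∅ i x ⇔ Klt U x (φ x)
  KBelow⇔ i x = mk⇔ (λ (y , ev-y , short) → subst (Klt U x) (Ev-functional ev-y (ev-uφ i x)) short)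
                    (λ short → φ x , ev-uφ i x , short)
  pair₀C : PR 1
  pair₀C = compile (pairE (lit 0) (var zero))
  e₁ e₂ : ℕ
  e₁ = proj₁ (index lowC)
  e₂ = proj₁ (index denseC)
  open Indexed {D = W} {A = ∅} smn (proj₂ (index lowC)) (proj₂ (index denseC))

relativised : ∀ (𝒰 : PR 1) → OptimalFunctional 𝒰 →
  ∀ (Φ : ℕ → ℕ → Oracle → ℕ → Set) → AcceptableFunctional Φ →
  Σ (ℕ → ℕ) λ ξ → Σ (ℕ → ℕ → ℕ) λ θ → Computable₁ ξ × Computable₂ θ ×
    (∀ i j (A : Oracle) →
      (∀ x → (∃ λ y → Φ i x A y × KA< 𝒰 A x y) ⇔ (∃ λ y → Φ (ξ i) x A y))
      × ((∀ n → ∃ λ x → ∃ λ y → (∃ λ v → Φ j x A v) × Φ i x A y × n < y) →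
           Infinite (λ x → ∃ λ y → Φ (θ i j) x A y)
           × (∀ x → (∃ λ y → Φ (θ i j) x A y) →
                (∃ λ v → Φ j x A v) × (∃ λ y → Φ i x A y × KA< 𝒰 A x y))))
relativised 𝒰 optimal Φ ((u , u-universal) , index , (s , s-computable , smn)) =
  s e₁ , (λ i j → s (s e₂ i) j) , smn-Computable₁ s-computable e₁ , smn-Computable₂ s-computable e₂ ,
  λ i j A → let open Indexed {D = λ i x → ∃ λ y → Φ i x A y} {A = A}
                              (λ i z x → ∃-⇔ (smn i z x A)) (index-at lowC A) (index-at denseC A) in
    (λ x → ⇔-trans (KBelow-via (λ i x → u-universal i x A) i x) (⇔-sym (ξ-correct i x))) ,
    λ unbounded →
      θ-infinite (optimal-at A)
        (λ n → let (x , y , v , φy , n<y) = unbounded n in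
               x , Equivalence.to (Dom⇔ A j x) v , y , Equivalence.to (u-universal i x A y) φy , n<y) ,
      λ x h → let (dom , below) = θ-sound i j x h in
              Equivalence.from (Dom⇔ A j x) dom , Equivalence.from (KBelow-via (λ i x → u-universal i x A) i x) below
  where
  open Construction u u 𝒰
  e₁ e₂ : ℕ
  e₁ = proj₁ (index lowC)
  e₂ = proj₁ (index denseC)
  index-at : ∀ c A w → (∃ λ y → Φ (proj₁ (index c)) w A y) ⇔ Halts A c w
  index-at c A w = ∃-⇔ (proj₂ (index c) w A)
  Dom⇔ : ∀ A j x → (∃ λ v → Φ j x A v) ⇔ Dom A j x
  Dom⇔ A j x = ∃-⇔ (u-universal j x A)
  optimal-at : ∀ A → OptimalAt A 𝒰
  optimal-at A g = map₂ (λ compress → compress A) (optimal g)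

lemmal :
    (∀ (U : PR 1) → Optimal U →
      (∀ (φ : ℕ → ℕ) → Computable₁ φ → TendsToInfinity φ →
        ∀ (W : ℕ → ℕ → Set) → AcceptableRE W →
          RE (λ x → Klt U x (φ x)) × ConstructivelyDense W (λ x → Klt U x (φ x)))
      × (∀ (φ : ℕ → ℕ → ℕ → Set) (W : ℕ → ℕ → Set) → AcceptablePR φ → AcceptableRE W →
          Σ (ℕ → ℕ) λ ξ → Σ (ℕ → ℕ → ℕ) λ θ → Computable₁ ξ × Computable₂ θ ×
            (∀ i x → (∃ λ y → φ i x y × Klt U x y) ⇔ W (ξ i) x)
            × (∀ i j → (∀ n → ∃ λ x → ∃ λ y → W j x × φ i x y × n < y) →
                 Infinite (W (θ i j))
                 × (∀ x → W (θ i j) x → W j x × (∃ λ y → φ i x y × Klt U x y)))))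
    ×
    (∀ (𝒰 : PR 1) → OptimalFunctional 𝒰 →
      ∀ (Φ : ℕ → ℕ → Oracle → ℕ → Set) → AcceptableFunctional Φ →
        Σ (ℕ → ℕ) λ ξ → Σ (ℕ → ℕ → ℕ) λ θ → Computable₁ ξ × Computable₂ θ ×
          (∀ i j (A : Oracle) →
            (∀ x → (∃ λ y → Φ i x A y × KA< 𝒰 A x y) ⇔ (∃ λ y → Φ (ξ i) x A y))
            × ((∀ n → ∃ λ x → ∃ λ y → (∃ λ v → Φ j x A v) × Φ i x A y × n < y) →
                 Infinite (λ x → ∃ λ y → Φ (θ i j) x A y)
                 × (∀ x → (∃ λ y → Φ (θ i j) x A y) →
                      (∃ λ v → Φ j x A v) × (∃ λ y → Φ i x A y × KA< 𝒰 A x y)))))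
lemmal = (λ U optimal → dense U optimal , uniform U optimal) , relativised
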